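{- Let $(\mathcal P,\preccurlyeq)$ be a finite poset which is graded of level $r$, i.e. there is a function $d:\mathcal P\to\{1,2,\dots,r\}$ such that $d^{ -1}(1)$ and $d^{ -1}(r)$ are non-empty and $d(y)=d(x)+1$ whenever $y$ covers $x$. Suppose moreover that $d^{ -1}(1)=\mathcal P_{min}$ and $d^{ -1}(r)=\mathcal P_{max}$. Then the reverse operator $\mathfrak X=\mathfrak X_{\mathcal P}$ has an orbit of cardinality $r+1$ on the set $\mathrm{AN}(\mathcal P)$ of antichains of $\mathcal P$.
   Context: For a subset $S\subset\mathcal P$, $S_{min}$ and $S_{max}$ denote the sets of minimal and maximal elements of $S$. An antichain is a subset of mutually incomparable elements (the empty set is an antichain); $\mathrm{AN}(\mathcal P)$ is the set of all antichains. For an antichain $\Gamma$, $\mathcal I(\Gamma)=\{x\in\mathcal P\mid \exists\gamma\in\Gamma,\ \gamma\preccurlyeq x\}$ is the upper ideal generated by $\Gamma$. The reverse operator $\mathfrak X:\mathrm{AN}(\mathcal P)\to\mathrm{AN}(\mathcal P)$ is defined by $\mathfrak X(\Gamma)=(\mathcal P\setminus\mathcal I(\Gamma))_{max}$; it is a permutation of $\mathrm{AN}(\mathcal P)$, and its orbits are the orbits of the cyclic group it generates. -}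

module Defs where

open import Level using (0ℓ)
open import Data.Nat using (ℕ; zero; suc; _≤_)
open import Data.Fin using (Fin)
open import Data.Fin.Subset using (Subset; _∈_; _∉_)
open import Data.Fin.Properties using (_≟_)
open import Data.Bool.ListAction using (any; all)
open import Data.List using () renaming (allFin to allFin)
open import Data.Bool using (Bool; true; false; not; _∧_; _∨_)
open import Data.Vec using (tabulate; lookup)
open import Data.Product using (Σ; _×_; _,_; ∃)
open import Function.Bundles using (_⇔_)
open import Relation.Binary using (Rel; Decidable; IsPartialOrder)
open import Relation.Binary.PropositionalEquality using (_≡_; _≢_)
open import Relation.Nullary using (¬_; Dec; yes; no; does)

module _ {n : ℕ} (_≼_ : Rel (Fin n) 0ℓ) where

  _≺_ : Rel (Fin n) 0ℓ
  x ≺ y = (x ≼ y) × (x ≢ y)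

  Covers : Fin n → Fin n → Set
  Covers y x = (x ≺ y) × (¬ (∃ λ z → (x ≺ z) × (z ≺ y)))

  IsMinimal : Fin n → Set
  IsMinimal x = ∀ y → y ≼ x → y ≡ x

  IsMaximal : Fin n → Set
  IsMaximal x = ∀ y → x ≼ y → y ≡ x

  IsAntichain : Subset n → Set
  IsAntichain Γ = ∀ x y → x ∈ Γ → y ∈ Γ → x ≼ y → x ≡ y

  GradedMinMax : (r : ℕ) → (Fin n → ℕ) → Set
  GradedMinMax r d =
      (∀ x → (1 ≤ d x) × (d x ≤ r))
    × (∃ λ x → d x ≡ 1)
    × (∃ λ x → d x ≡ r)
    × (∀ x y → Covers y x → d y ≡ suc (d x))
    × (∀ x → (d x ≡ 1) ⇔ IsMinimal x)
    × (∀ x → (d x ≡ r) ⇔ IsMaximal x)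

module _ {n : ℕ} {_≼_ : Rel (Fin n) 0ℓ} (_≼?_ : Decidable _≼_) where

  inIdeal : Subset n → Fin n → Bool
  inIdeal Γ x = any (λ γ → lookup Γ γ ∧ does (γ ≼? x)) (allFin n)

  -- the reverse operator 𝔛(Γ) = (P ∖ I(Γ))_max :
  -- x ∉ I(Γ), and every y ≽ x with y ∉ I(Γ) equals x
  revOp : Subset n → Subset n
  revOp Γ = tabulate λ x →
      not (inIdeal Γ x)
    ∧ all (λ y → not (does (x ≼? y)) ∨ inIdeal Γ y ∨ does (y ≟ x)) (allFin n)

  revOp^ : ℕ → Subset n → Subset n
  revOp^ zero    Γ = Γ
  revOp^ (suc k) Γ = revOp (revOp^ k Γ)

-- Write L k for the level set d⁻¹(k); L 0 = ∅ since d ≥ 1. Because d strictly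
-- increases along ≺ and every element of level > k lies above one of level k+1
-- (descend through lower covers; a minimal element has level 1), the upper ideal
-- generated by L (k+1) is {x | d x > k}. The maximal elements of its complement
-- {x | d x ≤ k} form exactly L k when k ≤ r: an element of level below k ≤ r is not
-- maximal, and an upper cover raises the level by one only. Together with 𝔛 ∅ = L r
-- this gives the orbit ∅ ↦ L r ↦ L (r−1) ↦ ⋯ ↦ L 1 ↦ ∅ of r+1 distinct antichains.

module Submission where

open import Defs
open import Level using (0ℓ)
open import Data.Nat using (ℕ; suc; _≤_)
open import Data.Fin using (Fin)
open import Data.Fin.Subset using (Subset)
open import Data.Product using (Σ; _×_; ∃)
open import Relation.Binary using (Rel; Decidable; IsPartialOrder)
open import Relation.Binary.PropositionalEquality using (_≡_; _≢_)

open import Data.Nat using (zero; _<_; _+_; s≤s; s≤s⁻¹)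
open import Data.Nat.Properties
  using (≤-refl; <⇒≤; <⇒≱; <-≤-trans; <-irrefl; ≤∧≢⇒<; ≮⇒≥; m≤m+n; m≤n⇒∃[o]m+o≡n; +-comm; +-suc; +-identityʳ)
  renaming (_≟_ to _≟ℕ_)
open import Data.Fin.Properties using (any?; _≟_)
open import Data.Fin.Subset using (_∈_; _∉_)
open import Data.Fin.Subset.Properties using (⊆-antisym)
open import Data.Fin.Induction using (po-wellFounded; po-noetherian)
open import Induction.WellFounded using (Acc; acc)
open import Data.Vec using (tabulate)
open import Data.Vec.Properties using (lookup∘tabulate; []=⇒lookup; lookup⇒[]=)
open import Data.List using (allFin)
open import Data.List.Relation.Unary.All as All using ()
open import Data.List.Relation.Unary.All.Properties using (all⁺; all⁻)
open import Data.List.Relation.Unary.Any as Any using ()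
open import Data.List.Relation.Unary.Any.Properties using (any⁺; any⁻)
open import Data.List.Membership.Propositional using (lose)
open import Data.List.Membership.Propositional.Properties using (∈-allFin)
open import Data.Bool using (Bool; true; false; T; not; _∨_)
open import Data.Bool.Properties using (T-≡; T-∧; T-∨)
open import Data.Bool.ListAction using (any; all)
open import Data.Product using (_,_; proj₁; proj₂)
open import Data.Sum using (_⊎_; inj₁; inj₂)
open import Function using (_∘_; flip)
open import Function.Bundles using (_⇔_; mk⇔; Equivalence)
open import Function.Properties.Equivalence using () renaming (trans to ⇔-trans)
open import Relation.Nullary using (¬_; Dec; yes; no; does; contradiction)
open import Relation.Nullary.Decidable using (_×-dec_; ¬?; decidable-stable)
open import Relation.Binary.PropositionalEquality using (refl; sym; trans; cong; subst; module ≡-Reasoning)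

open Equivalence using (to; from)
open ≡-Reasoning

T-not⇔¬T : ∀ {b} → T (not b) ⇔ (¬ T b)
T-not⇔¬T {false} = mk⇔ (λ _ ()) (λ _ → _)
T-not⇔¬T {true}  = mk⇔ (λ ()) (λ ¬t → ¬t _)

T-does⇔ : ∀ {P : Set} (P? : Dec P) → T (does P?) ⇔ P
T-does⇔ (yes p) = mk⇔ (λ _ → p) (λ _ → _)
T-does⇔ (no ¬p) = mk⇔ (λ ()) ¬p

module _ {n : ℕ} where

  T-any-allFin⇔ : {p : Fin n → Bool} → T (any p (allFin n)) ⇔ ∃ (T ∘ p)
  T-any-allFin⇔ {p} = mk⇔ (Any.satisfied ∘ any⁻ p (allFin n))
                           (λ (i , pi) → any⁺ p (lose (∈-allFin i) pi))

  T-all-allFin⇔ : {p : Fin n → Bool} → T (all p (allFin n)) ⇔ (∀ i → T (p i))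
  T-all-allFin⇔ {p} = mk⇔ (λ t i → All.lookup (all⁺ p (allFin n) t) (∈-allFin i))
                           (λ h → all⁻ p {allFin n} (All.tabulate λ {i} _ → h i))

  ∈-tabulate⇔ : {f : Fin n → Bool} {x : Fin n} → x ∈ tabulate f ⇔ T (f x)
  ∈-tabulate⇔ {f} {x} = mk⇔
    (λ x∈ → from T-≡ (trans (sym (lookup∘tabulate f x)) ([]=⇒lookup x∈)))
    (λ t → lookup⇒[]= x (tabulate f) (trans (lookup∘tabulate f x) (to T-≡ t)))

module _ {n : ℕ} {_≼_ : Rel (Fin n) 0ℓ} (_≼?_ : Decidable _≼_) where

  private
    _⊏_ : Rel (Fin n) 0ℓ
    _⊏_ = _≺_ _≼_

  InIdeal : Subset n → Fin n → Set
  InIdeal Γ x = ∃ λ γ → γ ∈ Γ × γ ≼ x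

  inIdeal⇔ : ∀ {Γ x} → T (inIdeal _≼?_ Γ x) ⇔ InIdeal Γ x
  inIdeal⇔ {Γ} {x} = mk⇔
    (λ t → let γ , γ∈∧γ≼x = to T-any-allFin⇔ t
               γ∈ , γ≼x = to T-∧ γ∈∧γ≼x
           in γ , lookup⇒[]= γ Γ (to T-≡ γ∈) , to (T-does⇔ (γ ≼? x)) γ≼x)
    (λ (γ , γ∈ , γ≼x) → from T-any-allFin⇔
       (γ , from T-∧ (from T-≡ ([]=⇒lookup γ∈) , from (T-does⇔ (γ ≼? x)) γ≼x)))

  ∈-revOp⇔ : ∀ {Γ x} → x ∈ revOp _≼?_ Γ ⇔ ((¬ InIdeal Γ x) × (∀ y → x ⊏ y → InIdeal Γ y))
  ∈-revOp⇔ {Γ} {x} = mk⇔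
    (λ x∈ → let outside , maximal = to T-∧ (to ∈-tabulate⇔ x∈)
            in  to T-not⇔¬T outside ∘ from inIdeal⇔
              , λ y → above y (to T-all-allFin⇔ maximal y))
    (λ (outside , maximal) → from ∈-tabulate⇔ (from T-∧
       ( from T-not⇔¬T (outside ∘ to inIdeal⇔)
       , from T-all-allFin⇔ λ y → below y (maximal y))))
    where
    above : ∀ y → T (not (does (x ≼? y)) ∨ inIdeal _≼?_ Γ y ∨ does (y ≟ x)) → x ⊏ y → InIdeal Γ y
    above y t (x≼y , x≢y) with to T-∨ t
    ... | inj₁ x⋠y = contradiction (from (T-does⇔ (x ≼? y)) x≼y) (to T-not⇔¬T x⋠y)
    ... | inj₂ t′ with to T-∨ t′
    ...   | inj₁ y∈I = to inIdeal⇔ y∈I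
    ...   | inj₂ y≡x = contradiction (sym (to (T-does⇔ (y ≟ x)) y≡x)) x≢y
    below : ∀ y → (x ⊏ y → InIdeal Γ y) → T (not (does (x ≼? y)) ∨ inIdeal _≼?_ Γ y ∨ does (y ≟ x))
    below y h with x ≼? y | y ≟ x
    ... | no _    | _       = _
    ... | yes _   | yes _   = from (T-∨ {inIdeal _≼?_ Γ y}) (inj₂ _)
    ... | yes x≼y | no y≢x  = from (T-∨ {inIdeal _≼?_ Γ y}) (inj₁ (from inIdeal⇔ (h (x≼y , y≢x ∘ sym))))

  module _ (po : IsPartialOrder _≡_ _≼_) where

    open IsPartialOrder po using () renaming (refl to ≼-refl; trans to ≼-trans)

    _⊏?_ : Decidable _⊏_
    x ⊏? y = (x ≼? y) ×-dec ¬? (x ≟ y)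

    upperCover : ∀ {x y} → x ⊏ y → ∃ λ z → Covers _≼_ z x
    upperCover = go (po-wellFounded po _)
      where
      go : ∀ {x y} → Acc _⊏_ y → x ⊏ y → ∃ λ z → Covers _≼_ z x
      go {x} {y} (acc rec) x⊏y with any? (λ z → (x ⊏? z) ×-dec (z ⊏? y))
      ... | no ∄z                = y , x⊏y , ∄z
      ... | yes (z , x⊏z , z⊏y) = go (rec z⊏y) x⊏z

    lowerCover : ∀ {x y} → x ⊏ y → ∃ λ z → Covers _≼_ y z × x ≼ z
    lowerCover {x} = go (po-noetherian po x)
      where
      go : ∀ {x y} → Acc (flip _⊏_) x → x ⊏ y → ∃ λ z → Covers _≼_ y z × x ≼ z
      go {x} {y} (acc rec) x⊏y with any? (λ z → (x ⊏? z) ×-dec (z ⊏? y))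
      ... | no ∄z                = x , (x⊏y , ∄z) , ≼-refl
      ... | yes (z , x⊏z , z⊏y) =
        let w , y⋗w , z≼w = go (rec x⊏z) z⊏y in w , y⋗w , ≼-trans (proj₁ x⊏z) z≼w

    lowerCover-or-minimal : ∀ y → (∃ λ z → Covers _≼_ y z) ⊎ IsMinimal _≼_ y
    lowerCover-or-minimal y with any? (_⊏? y)
    ... | yes (_ , w⊏y) = let z , y⋗z , _ = lowerCover w⊏y in inj₁ (z , y⋗z)
    ... | no ∄w         = inj₂ λ w w≼y → decidable-stable (w ≟ y) λ w≢y → ∄w (w , w≼y , w≢y)

    upperCover-or-maximal : ∀ x → (∃ λ z → Covers _≼_ z x) ⊎ IsMaximal _≼_ x
    upperCover-or-maximal x with any? (x ⊏?_)
    ... | yes (_ , x⊏w) = inj₁ (upperCover x⊏w)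
    ... | no ∄w         = inj₂ λ w x≼w → decidable-stable (w ≟ x) λ w≢x → ∄w (w , x≼w , w≢x ∘ sym)

    module Graded (d : Fin n → ℕ) (d-cover : ∀ x y → Covers _≼_ y x → d y ≡ suc (d x)) where

      d-strictMono : ∀ {x y} → x ⊏ y → d x < d y
      d-strictMono {y = y} = go (po-wellFounded po y)
        where
        go : ∀ {x y} → Acc _⊏_ y → x ⊏ y → d x < d y
        go {x} {y} (acc rec) x⊏y with lowerCover x⊏y
        ... | z , y⋗z , x≼z = subst (d x <_) (sym (d-cover z y y⋗z)) (s≤s dx≤dz)
          where
          dx≤dz : d x ≤ d z
          dx≤dz with x ≟ z
          ... | yes refl = ≤-refl
          ... | no x≢z   = <⇒≤ (go (rec (proj₁ y⋗z)) (x≼z , x≢z))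

      d-mono : ∀ {x y} → x ≼ y → d x ≤ d y
      d-mono {x} {y} x≼y with x ≟ y
      ... | yes refl = ≤-refl
      ... | no x≢y   = <⇒≤ (d-strictMono (x≼y , x≢y))

      level : ℕ → Subset n
      level k = tabulate λ x → does (d x ≟ℕ k)

      ∈-level⇔ : ∀ {k x} → x ∈ level k ⇔ d x ≡ k
      ∈-level⇔ {k} {x} = ⇔-trans ∈-tabulate⇔ (T-does⇔ (d x ≟ℕ k))

      level-zero-empty : (∀ x → 1 ≤ d x) → ∀ {x} → x ∉ level 0
      level-zero-empty positive {x} x∈ = contradiction (subst (1 ≤_) (to ∈-level⇔ x∈) (positive x)) λ ()

      -- Covers both Γ = L (m+1) and Γ = ∅ with m = r.
      revOp-level : ∀ {r} → (∀ x → IsMaximal _≼_ x → d x ≡ r) → ∀ {m Γ} → m ≤ r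
                  → (∀ {x} → InIdeal Γ x ⇔ m < d x) → revOp _≼?_ Γ ≡ level m
      revOp-level {r} maximal⇒r {m} {Γ} m≤r ideal = ⊆-antisym
        (λ {x} x∈ → from ∈-level⇔ (top-of-complement (to ∈-revOp⇔ x∈)))
        (λ {x} x∈ → from ∈-revOp⇔ (level-outside (to ∈-level⇔ x∈) , level-maximal (to ∈-level⇔ x∈)))
        where
        level-outside : ∀ {x} → d x ≡ m → ¬ InIdeal Γ x
        level-outside dx≡m x∈I = <-irrefl refl (subst (m <_) dx≡m (to ideal x∈I))
        level-maximal : ∀ {x} → d x ≡ m → ∀ y → x ⊏ y → InIdeal Γ y
        level-maximal dx≡m y x⊏y = from ideal (subst (_< d y) dx≡m (d-strictMono x⊏y))
        top-of-complement : ∀ {x} → (¬ InIdeal Γ x) × (∀ y → x ⊏ y → InIdeal Γ y) → d x ≡ m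
        top-of-complement {x} (outside , maximal) =
          decidable-stable (d x ≟ℕ m) λ dx≢m → not-below (≤∧≢⇒< (≮⇒≥ (outside ∘ from ideal)) dx≢m)
          where
          not-below : ¬ d x < m
          not-below dx<m with upperCover-or-maximal x
          ... | inj₁ (y , y⋗x) =
                <⇒≱ dx<m (s≤s⁻¹ (subst (m <_) (d-cover x y y⋗x) (to ideal (maximal y (proj₁ y⋗x)))))
          ... | inj₂ x-maximal = <-irrefl (maximal⇒r x x-maximal) (<-≤-trans dx<m m≤r)

      module _ (minimal⇒1 : ∀ x → IsMinimal _≼_ x → d x ≡ 1) where

        descend : ∀ {k y} → suc k ≤ d y → ∃ λ x → x ≼ y × d x ≡ suc k
        descend {k} {y} = go (po-wellFounded po y)
          where
          go : ∀ {y} → Acc _⊏_ y → suc k ≤ d y → ∃ λ x → x ≼ y × d x ≡ suc k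
          go {y} (acc rec) k<dy with d y ≟ℕ suc k
          ... | yes dy≡sk = y , ≼-refl , dy≡sk
          ... | no dy≢sk = step (lowerCover-or-minimal y) (≤∧≢⇒< k<dy (dy≢sk ∘ sym))
            where
            step : (∃ λ z → Covers _≼_ y z) ⊎ IsMinimal _≼_ y → suc k < d y
                 → ∃ λ x → x ≼ y × d x ≡ suc k
            step (inj₁ (z , y⋗z)) sk<dy =
              let x , x≼z , dx≡sk = go (rec (proj₁ y⋗z)) (s≤s⁻¹ (subst (suc k <_) (d-cover z y y⋗z) sk<dy))
              in  x , ≼-trans x≼z (proj₁ (proj₁ y⋗z)) , dx≡sk
            step (inj₂ y-minimal) sk<dy =
              contradiction (subst (suc k <_) (minimal⇒1 y y-minimal) sk<dy) λ { (s≤s ()) }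

        inIdeal-level⇔ : ∀ {k x} → InIdeal (level (suc k)) x ⇔ suc k ≤ d x
        inIdeal-level⇔ {k} {x} = mk⇔
          (λ (γ , γ∈ , γ≼x) → subst (_≤ d x) (to ∈-level⇔ γ∈) (d-mono γ≼x))
          (λ k<dx → let γ , γ≼x , dγ≡sk = descend k<dx in γ , from ∈-level⇔ dγ≡sk , γ≼x)

        level-suc≢level-zero : (∀ x → 1 ≤ d x) → ∀ {r} → (∃ λ x → d x ≡ r)
                             → ∀ {k} → suc k ≤ r → level (suc k) ≢ level 0
        level-suc≢level-zero positive (top , d-top) k<r level-sk≡level-0 =
          let x , _ , dx≡sk = descend (subst (_ ≤_) (sym d-top) k<r)
          in  level-zero-empty positive (subst (x ∈_) level-sk≡level-0 (from ∈-level⇔ dx≡sk))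

        module _ {r : ℕ} (bounded : ∀ x → 1 ≤ d x × d x ≤ r)
                 (maximal⇒r : ∀ x → IsMaximal _≼_ x → d x ≡ r) where

          revOp-level-zero : revOp _≼?_ (level 0) ≡ level r
          revOp-level-zero = revOp-level maximal⇒r ≤-refl λ {x} → mk⇔
            (λ (γ , γ∈ , _) → contradiction γ∈ (level-zero-empty (proj₁ ∘ bounded)))
            (λ r<dx → contradiction (proj₂ (bounded x)) (<⇒≱ r<dx))

          revOp^-level-zero : ∀ j {i} → i + j ≡ r → revOp^ _≼?_ (suc j) (level 0) ≡ level i
          revOp^-level-zero zero {i} i+0≡r =
            trans revOp-level-zero (cong level (trans (sym i+0≡r) (+-identityʳ i)))
          revOp^-level-zero (suc j) {i} i+sj≡r = begin
            revOp _≼?_ (revOp^ _≼?_ (suc j) (level 0)) ≡⟨ cong (revOp _≼?_) (revOp^-level-zero j si+j≡r) ⟩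
            revOp _≼?_ (level (suc i))                  ≡⟨ revOp-level maximal⇒r i≤r inIdeal-level⇔ ⟩
            level i                                     ∎
            where
            si+j≡r : suc i + j ≡ r
            si+j≡r = trans (sym (+-suc i j)) i+sj≡r
            i≤r : i ≤ r
            i≤r = <⇒≤ (subst (suc i ≤_) si+j≡r (m≤m+n (suc i) j))

          revOp^-level-zero-period : revOp^ _≼?_ (suc r) (level 0) ≡ level 0
          revOp^-level-zero-period = revOp^-level-zero r refl

          revOp^-level-zero-aperiodic : (∃ λ x → d x ≡ r)
                                      → ∀ k → 1 ≤ k → k ≤ r → revOp^ _≼?_ k (level 0) ≢ level 0
          revOp^-level-zero-aperiodic top (suc j) _ sj≤r with m≤n⇒∃[o]m+o≡n sj≤r
          ... | o , sj+o≡r =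
            level-suc≢level-zero (proj₁ ∘ bounded) top so≤r ∘ trans (sym (revOp^-level-zero j so+j≡r))
            where
            so+j≡r : suc o + j ≡ r
            so+j≡r = trans (cong suc (+-comm o j)) sj+o≡r
            so≤r : suc o ≤ r
            so≤r = subst (suc o ≤_) so+j≡r (m≤m+n (suc o) j)

lemma1p1 : (n : ℕ) (_≼_ : Rel (Fin n) 0ℓ) → IsPartialOrder _≡_ _≼_ → (_≼?_ : Decidable _≼_)
    → (r : ℕ) (d : Fin n → ℕ) → GradedMinMax _≼_ r d
    → ∃ λ (Γ : Subset n) → IsAntichain _≼_ Γ
        × (revOp^ _≼?_ (suc r) Γ ≡ Γ)
        × (∀ k → 1 ≤ k → k ≤ r → revOp^ _≼?_ k Γ ≢ Γ)
lemma1p1 _ _≼_ po _≼?_ r d (bounded , _ , top , d-cover , minimal⇔1 , maximal⇔r) =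
    level 0
  , (λ x _ x∈ _ _ → contradiction x∈ (level-zero-empty (proj₁ ∘ bounded)))
  , revOp^-level-zero-period minimal⇒1 bounded maximal⇒r
  , revOp^-level-zero-aperiodic minimal⇒1 bounded maximal⇒r top
  where
  open Graded _≼?_ po d d-cover
  minimal⇒1 : ∀ x → IsMinimal _≼_ x → d x ≡ 1
  minimal⇒1 x = from (minimal⇔1 x)
  maximal⇒r : ∀ x → IsMaximal _≼_ x → d x ≡ r
  maximal⇒r x = from (maximal⇔r x)
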